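{- Let $T$ be a tree, let $k$ be a positive integer, and let $R_1,R_2,\dots,R_m$ be pairwise disjoint sets of vertices of $T$ such that $|R_i|>(mk-1)^2$ for each $i\in[m]$. Then there exist a subtree $T'$ of $T$ and sets $R_1',\dots,R_m'$ such that for each $i\in[m]$, $R_i'\subseteq R_i\cap V(T')$, $|R_i'|=k$, and each vertex of $R_i'$ has degree at most $m^2+1$ in $T'$.
   Context: $[m]=\{1,\dots,m\}$. -}

module Defs where

open import Data.Nat using (ℕ; _≤_)
open import Data.Bool using (Bool; true; false)
open import Data.Fin using (Fin)
open import Data.Fin.Subset using (Subset; _∈_; _∩_; ∣_∣; Nonempty; ⊤)
open import Data.Vec using (tabulate)
open import Data.List using (List; []; _∷_; length; _∷ʳ_)
open import Data.List.Relation.Unary.Linked using (Linked)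
open import Data.List.Relation.Unary.Unique.Propositional using (Unique)
open import Data.Product using (_×_)
open import Relation.Binary.PropositionalEquality using (_≡_)
open import Relation.Nullary using (¬_)

record Graph (n : ℕ) : Set where
  field
    adj   : Fin n → Fin n → Bool
    sym   : ∀ u v → adj u v ≡ adj v u
    irrefl : ∀ v → adj v v ≡ false

module _ {n : ℕ} (G : Graph n) where
  open Graph G

  Adj : Fin n → Fin n → Set
  Adj u v = adj u v ≡ true

  data WalkIn (S : Subset n) : Fin n → Fin n → Set where
    here : ∀ {u} → u ∈ S → WalkIn S u u
    step : ∀ {u w v} → u ∈ S → Adj u w → WalkIn S w v → WalkIn S u v

  ConnectedIn : Subset n → Set
  ConnectedIn S = ∀ u v → u ∈ S → v ∈ S → WalkIn S u v

  -- a cycle: distinct vertices v ∷ ws, at least 3 of them,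
  -- consecutive ones adjacent and the last adjacent to v
  IsCycle : Fin n → List (Fin n) → Set
  IsCycle v ws = Unique (v ∷ ws) × (2 ≤ length ws) × Linked Adj (v ∷ ws ∷ʳ v)

  Acyclic : Set
  Acyclic = ∀ v ws → ¬ IsCycle v ws

  IsTree : Set
  IsTree = Nonempty (⊤ {n}) × ConnectedIn ⊤ × Acyclic

  -- a subtree: nonempty vertex set inducing a connected subgraph
  -- (in a tree, a connected subgraph on S is exactly the induced subgraph on S)
  IsSubtree : Subset n → Set
  IsSubtree S = Nonempty S × ConnectedIn S

  N : Fin n → Subset n
  N v = tabulate (adj v)

  degIn : Subset n → Fin n → ℕ
  degIn S v = ∣ N v ∩ S ∣

-- Root the tree. The ancestor order is a partial order in which the ancestors of any vertex form a
-- chain, so Mirsky's layering argument finds in each R i a chain or an antichain C i of exactly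
-- t = m k vertices. Call the at most m t vertices of the C j marked, and let T′ be the union of their
-- paths to the root: it is closed under parents, hence a subtree. Fix i and call a child c of a
-- vertex of C i a stub if c ∈ T′ but no vertex of C i lies at or below c. Sending each stub to a
-- marked vertex below it is injective and avoids C i, so there are at most (m - 1) t stubs, and
-- hence at most t - k vertices of C i with m or more stub children. Every other q ∈ C i has in T′
-- only its parent, at most m - 1 stub children and at most one further child (the one through which
-- the chain continues; an antichain continues through none), so its degree is at most m + 1 ≤ m² + 1.
module Submission where

open import Defs
open import Level using (Level; 0ℓ)
open import Data.Nat using (ℕ; zero; suc; _+_; _*_; _∸_; _^_; _≤_; _<_; z≤n; s≤s; s≤s⁻¹; _≤?_; _<?_; >-nonZero)
  renaming (_≟_ to _≟ₙ_)
open import Data.Nat.Properties hiding (_≟_)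
open import Data.Bool using (Bool; true)
import Data.Bool.Properties as Boolₚ
open import Data.Fin using (Fin; zero; suc; _≟_; toℕ; fromℕ<)
open import Data.Fin.Properties using (any?; toℕ<n; toℕ-fromℕ<)
import Data.Fin.Properties as Finₚ
open import Data.Fin.Subset using (Subset; _∈_; _∉_; _⊆_; _∩_; ∣_∣; inside; outside; ⊥; ⊤)
open import Data.Fin.Subset.Properties using (_∈?_; ∉⊥; ∣⊥∣≡0; drop-there; ∈⊤; x∈p∩q⁻; ⊆-trans)
open import Data.Vec using (_∷_; []; here; there; tabulate)
open import Data.Vec.Properties using (lookup∘tabulate; []=⇒lookup; lookup⇒[]=)
open import Data.List using (List; []; _∷_; _++_; [_]; length)
open import Data.List.Properties using (length-++)
open import Data.List.Relation.Unary.All as All using (All; []; _∷_)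
open import Data.List.Relation.Unary.All.Properties using (∷ʳ⁺)
open import Data.List.Relation.Unary.AllPairs using (AllPairs; []; _∷_)
import Data.List.Relation.Unary.AllPairs.Properties as AllPairsₚ
open import Data.List.Relation.Unary.Linked using (Linked; []; [-]; _∷_)
open import Data.Product using (Σ; ∃; _×_; _,_; proj₁; proj₂)
open import Data.Sum using (_⊎_; inj₁; inj₂)
open import Function using (_∘_)
open import Relation.Binary using (Rel; IsPartialOrder; tri<; tri≈; tri>)
import Relation.Binary
open import Relation.Binary.PropositionalEquality hiding ([_])
open import Relation.Nullary using (Dec; yes; no; ¬_; contradiction; does)
open import Relation.Nullary.Decidable using (_×-dec_; _⊎-dec_; ¬?; dec-true)
open import Relation.Unary using (Pred; Decidable)
open import Relation.Unary.Properties using (∅?)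

private
  variable
    ℓ p q : Level

count : ∀ {n} {P : Pred (Fin n) p} → Decidable P → ℕ
count {n = zero}  P? = 0
count {n = suc n} P? with P? zero
... | yes _ = suc (count (P? ∘ suc))
... | no  _ = count (P? ∘ suc)

count-mono : ∀ {n} {P : Pred (Fin n) p} {Q : Pred (Fin n) q} (P? : Decidable P) (Q? : Decidable Q) →
             (∀ {x} → P x → Q x) → count P? ≤ count Q?
count-mono {n = zero}  P? Q? P⊆Q = z≤n
count-mono {n = suc n} P? Q? P⊆Q with P? zero | Q? zero
... | yes _  | yes _  = s≤s (count-mono (P? ∘ suc) (Q? ∘ suc) P⊆Q)
... | yes p₀ | no ¬q₀ = contradiction (P⊆Q p₀) ¬q₀
... | no _   | yes _  = m≤n⇒m≤1+n (count-mono (P? ∘ suc) (Q? ∘ suc) P⊆Q)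
... | no _   | no _   = count-mono (P? ∘ suc) (Q? ∘ suc) P⊆Q

count-cong : ∀ {n} {P : Pred (Fin n) p} {Q : Pred (Fin n) q} (P? : Decidable P) (Q? : Decidable Q) →
             (∀ {x} → P x → Q x) → (∀ {x} → Q x → P x) → count P? ≡ count Q?
count-cong P? Q? P⊆Q Q⊆P = ≤-antisym (count-mono P? Q? P⊆Q) (count-mono Q? P? Q⊆P)

count-none : ∀ {n} {P : Pred (Fin n) p} (P? : Decidable P) → (∀ x → ¬ P x) → count P? ≡ 0
count-none {n = zero}  P? ¬P = refl
count-none {n = suc n} P? ¬P with P? zero
... | yes p₀ = contradiction p₀ (¬P zero)
... | no _   = count-none (P? ∘ suc) (¬P ∘ suc)

count>0⇒∃ : ∀ {n} {P : Pred (Fin n) p} (P? : Decidable P) → 0 < count P? → ∃ P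
count>0⇒∃ P? 0<c with any? P?
... | yes ∃P  = ∃P
... | no  ¬∃P = contradiction (count-none P? (λ x Px → ¬∃P (x , Px))) (>⇒≢ 0<c)

count-∪ : ∀ {n} {P : Pred (Fin n) p} {Q : Pred (Fin n) q} (P? : Decidable P) (Q? : Decidable Q) →
          count (λ x → P? x ⊎-dec Q? x) ≤ count P? + count Q?
count-∪ {n = zero}  P? Q? = z≤n
count-∪ {n = suc n} P? Q? with P? zero | Q? zero | count-∪ (P? ∘ suc) (Q? ∘ suc)
... | yes _ | yes _ | ih = s≤s (≤-trans ih (+-monoʳ-≤ (count (P? ∘ suc)) (n≤1+n _)))
... | yes _ | no _  | ih = s≤s ih
... | no _  | yes _ | ih = ≤-trans (s≤s ih) (≤-reflexive (sym (+-suc _ _)))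
... | no _  | no _  | ih = ih

count-split : ∀ {n} {P : Pred (Fin n) p} {Q : Pred (Fin n) q} (P? : Decidable P) (Q? : Decidable Q) →
              count P? ≡ count (λ x → P? x ×-dec Q? x) + count (λ x → P? x ×-dec ¬? (Q? x))
count-split {n = zero}  P? Q? = refl
count-split {n = suc n} P? Q? with P? zero | Q? zero | count-split (P? ∘ suc) (Q? ∘ suc)
... | yes _ | yes _ | ih = cong suc ih
... | yes _ | no _  | ih = trans (cong suc ih) (sym (+-suc _ _))
... | no _  | _     | ih = ih

count-≤1 : ∀ {n} {P : Pred (Fin n) p} (P? : Decidable P) → (∀ {x y} → P x → P y → x ≡ y) → count P? ≤ 1
count-≤1 {n = zero}  P? unique = z≤n
count-≤1 {n = suc n} P? unique with P? zero
... | yes p₀ = ≤-reflexive (cong suc (count-none (P? ∘ suc) (λ x Px → Finₚ.0≢1+n (unique p₀ Px))))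
... | no _   = count-≤1 (P? ∘ suc) (λ Px Py → Finₚ.suc-injective (unique Px Py))

count-strict : ∀ {n} {P : Pred (Fin n) p} {Q : Pred (Fin n) q} (P? : Decidable P) (Q? : Decidable Q) →
               (∀ {x} → P x → Q x) → ∀ a → Q a → ¬ P a → count P? < count Q?
count-strict P? Q? P⊆Q zero Qa ¬Pa with P? zero | Q? zero
... | yes Pa | _      = contradiction Pa ¬Pa
... | no _   | yes _  = s≤s (count-mono (P? ∘ suc) (Q? ∘ suc) P⊆Q)
... | no _   | no ¬Qa = contradiction Qa ¬Qa
count-strict P? Q? P⊆Q (suc a) Qa ¬Pa with P? zero | Q? zero | count-strict (P? ∘ suc) (Q? ∘ suc) P⊆Q a Qa ¬Pa
... | yes _  | yes _  | ih = s≤s ih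
... | yes P₀ | no ¬Q₀ | ih = contradiction (P⊆Q P₀) ¬Q₀
... | no _   | yes _  | ih = m≤n⇒m≤1+n ih
... | no _   | no _   | ih = ih

count-remove : ∀ {n} {P : Pred (Fin n) p} (P? : Decidable P) → ∀ a → P a →
               count P? ≡ suc (count (λ x → P? x ×-dec ¬? (x ≟ a)))
count-remove {P = P} P? a Pa = ≤-antisym
  (begin
    count P?                                  ≤⟨ count-mono P? (λ x → P-a? x ⊎-dec (x ≟ a)) split ⟩
    count (λ x → P-a? x ⊎-dec (x ≟ a))        ≤⟨ count-∪ P-a? (_≟ a) ⟩
    count P-a? + count (_≟ a)                 ≤⟨ +-monoʳ-≤ (count P-a?) (count-≤1 (_≟ a) (λ x≡a y≡a → trans x≡a (sym y≡a))) ⟩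
    count P-a? + 1                            ≡⟨ +-comm (count P-a?) 1 ⟩
    suc (count P-a?)                          ∎)
  (count-strict P-a? P? proj₁ a Pa (λ (_ , a≢a) → a≢a refl))
  where
  open ≤-Reasoning
  P-a? : Decidable (λ x → P x × x ≢ a)
  P-a? x = P? x ×-dec ¬? (x ≟ a)
  split : ∀ {x} → P x → P x × x ≢ a ⊎ x ≡ a
  split {x} Px with x ≟ a
  ... | yes x≡a = inj₂ x≡a
  ... | no  x≢a = inj₁ (Px , x≢a)

count>0 : ∀ {n} {P : Pred (Fin n) p} (P? : Decidable P) → ∀ {a} → P a → 0 < count P?
count>0 P? {a} Pa = ≤-trans (s≤s z≤n) (≤-reflexive (sym (count-remove P? a Pa)))

count-injection : ∀ {n n′} {P : Pred (Fin n) p} {Q : Pred (Fin n′) q} (P? : Decidable P) (Q? : Decidable Q) →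
                  (f : Fin n → Fin n′) → (∀ {x} → P x → Q (f x)) →
                  (∀ {x y} → P x → P y → f x ≡ f y → x ≡ y) → count P? ≤ count Q?
count-injection {n = zero}  P? Q? f maps inj = z≤n
count-injection {n = suc n} {P = P} {Q} P? Q? f maps inj with P? zero
... | no _   = count-injection (P? ∘ suc) Q? (f ∘ suc) maps (λ Px Py fx≡fy → Finₚ.suc-injective (inj Px Py fx≡fy))
... | yes P₀ = begin
    suc (count (P? ∘ suc))                            ≤⟨ s≤s (count-injection (P? ∘ suc) Q-f₀? (f ∘ suc) maps′ inj′) ⟩
    suc (count Q-f₀?)                                 ≡⟨ count-remove Q? (f zero) (maps P₀) ⟨
    count Q?                                          ∎
  where
  open ≤-Reasoning
  Q-f₀? : Decidable (λ y → Q y × y ≢ f zero)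
  Q-f₀? y = Q? y ×-dec ¬? (y ≟ f zero)
  maps′ : ∀ {x} → P (suc x) → Q (f (suc x)) × f (suc x) ≢ f zero
  maps′ Px = maps Px , λ fx≡f₀ → Finₚ.0≢1+n (sym (inj Px P₀ fx≡f₀))
  inj′ : ∀ {x y} → P (suc x) → P (suc y) → f (suc x) ≡ f (suc y) → x ≡ y
  inj′ Px Py fx≡fy = Finₚ.suc-injective (inj Px Py fx≡fy)

count-⋃ : ∀ {n} m {P : Fin m → Pred (Fin n) p} (P? : ∀ j → Decidable (P j)) b →
          (∀ j → count (P? j) ≤ b) → count (λ x → any? (λ j → P? j x)) ≤ m * b
count-⋃ zero    P? b bounded = ≤-reflexive (count-none (λ x → any? (λ j → P? j x)) (λ { x (() , _) }))
count-⋃ (suc m) {P} P? b bounded = begin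
  count (λ x → any? (λ j → P? j x))                         ≤⟨ count-mono (λ x → any? (λ j → P? j x)) (λ x → P? zero x ⊎-dec any? (λ j → P? (suc j) x)) split ⟩
  count (λ x → P? zero x ⊎-dec any? (λ j → P? (suc j) x))   ≤⟨ count-∪ (P? zero) _ ⟩
  count (P? zero) + count (λ x → any? (λ j → P? (suc j) x)) ≤⟨ +-mono-≤ (bounded zero) (count-⋃ m (P? ∘ suc) b (bounded ∘ suc)) ⟩
  b + m * b                                                 ∎
  where
  open ≤-Reasoning
  split : ∀ {x} → ∃ (λ j → P j x) → P zero x ⊎ ∃ (λ j → P (suc j) x)
  split (zero  , P₀x) = inj₁ P₀x
  split (suc j , Pjx) = inj₂ (j , Pjx)

count-fibres : ∀ {n n′} {B : Pred (Fin n′) p} {U : Pred (Fin n) q} (B? : Decidable B) (U? : Decidable U) →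
               ∀ m (f : Fin n → Fin n′) → (∀ {y} → B y → m ≤ count (λ x → U? x ×-dec (f x ≟ y))) →
               m * count B? ≤ count U?
count-fibres B? U? m f large = go (count B?) B? U? refl large
  where
  go : ∀ {p q} {B : Pred _ p} {U : Pred _ q} → ∀ c → (B? : Decidable B) (U? : Decidable U) → count B? ≡ c →
       (∀ {y} → B y → m ≤ count (λ x → U? x ×-dec (f x ≟ y))) → m * c ≤ count U?
  go zero    B? U? _   large = ≤-trans (≤-reflexive (*-zeroʳ m)) z≤n
  go {B = B} {U} (suc c) B? U? |B| large with count>0⇒∃ B? (≤-trans (s≤s z≤n) (≤-reflexive (sym |B|)))
  ... | y , By = begin
    m * suc c                                                        ≡⟨ *-suc m c ⟩
    m + m * c                                                        ≤⟨ +-mono-≤ (large By) (go c B-y? U-y? |B-y| large′) ⟩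
    count (λ x → U? x ×-dec (f x ≟ y)) + count U-y?                  ≡⟨ count-split U? (λ x → f x ≟ y) ⟨
    count U?                                                         ∎
    where
    open ≤-Reasoning
    B-y? : Decidable (λ y′ → B y′ × y′ ≢ y)
    B-y? y′ = B? y′ ×-dec ¬? (y′ ≟ y)
    U-y? : Decidable (λ x → U x × f x ≢ y)
    U-y? x = U? x ×-dec ¬? (f x ≟ y)
    |B-y| : count B-y? ≡ c
    |B-y| = suc-injective (trans (sym (count-remove B? y By)) |B|)
    large′ : ∀ {y′} → B y′ × y′ ≢ y → m ≤ count (λ x → U-y? x ×-dec (f x ≟ y′))
    large′ {y′} (By′ , y′≢y) = ≤-trans (large By′)
      (count-mono (λ x → U? x ×-dec (f x ≟ y′)) (λ x → U-y? x ×-dec (f x ≟ y′))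
                  (λ (Ux , fx≡y′) → (Ux , λ fx≡y → y′≢y (trans (sym fx≡y′) fx≡y)) , fx≡y′))

subset-of-size : ∀ {n} {P : Pred (Fin n) p} (P? : Decidable P) k → k ≤ count P? →
                 Σ (Subset n) λ S → (∀ {x} → x ∈ S → P x) × ∣ S ∣ ≡ k
subset-of-size {n = n} P? zero _ = ⊥ , (λ x∈⊥ → contradiction x∈⊥ ∉⊥) , ∣⊥∣≡0 n
subset-of-size {n = suc n} P? (suc k) k<c with P? zero
... | yes P₀ with subset-of-size (P? ∘ suc) k (s≤s⁻¹ k<c)
...   | S , S⊆P , |S| = inside ∷ S , (λ { here → P₀ ; (there x∈S) → S⊆P x∈S }) , cong suc |S|
subset-of-size {n = suc n} P? (suc k) k<c | no _ with subset-of-size (P? ∘ suc) (suc k) k<c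
...   | S , S⊆P , |S| = outside ∷ S , (λ { (there x∈S) → S⊆P x∈S }) , |S|

∣p∣≡count : ∀ {n} (S : Subset n) → ∣ S ∣ ≡ count (_∈? S)
∣p∣≡count []            = refl
∣p∣≡count (inside  ∷ S) = cong suc (trans (∣p∣≡count S) (count-cong (_∈? S) _ there drop-there))
∣p∣≡count (outside ∷ S) = trans (∣p∣≡count S) (count-cong (_∈? S) _ there drop-there)

choose : ∀ {n} {P : Pred (Fin n) p} → Decidable P → Fin n → Fin n
choose P? default with any? P?
... | yes (x , _) = x
... | no _        = default

choose-satisfies : ∀ {n} {P : Pred (Fin n) p} (P? : Decidable P) default → ∃ P → P (choose P? default)
choose-satisfies P? default ∃P with any? P?
... | yes (_ , Px) = Px
... | no  ¬∃P      = contradiction ∃P ¬∃P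

choose-default : ∀ {n} {P : Pred (Fin n) p} (P? : Decidable P) default → ¬ ∃ P → choose P? default ≡ default
choose-default P? default ¬∃P with any? P?
... | yes ∃P = contradiction ∃P ¬∃P
... | no  _  = refl

least-witness : ∀ {P : Pred ℕ p} → Decidable P → ∀ b → P b → Σ ℕ λ j → P j × (∀ i → P i → j ≤ i)
least-witness P? zero    P₀ = 0 , P₀ , λ _ _ → z≤n
least-witness P? (suc b) Pb with P? 0 | least-witness (P? ∘ suc) b Pb
... | yes P₀ | _ = 0 , P₀ , λ _ _ → z≤n
... | no ¬P₀ | j , Pj , least = suc j , Pj , λ { zero P₀ → contradiction P₀ ¬P₀ ; (suc i) Pi → s≤s (least i Pi) }

Chain : ∀ {n} → Rel (Fin n) ℓ → Pred (Fin n) p → Set _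
Chain _≼_ C = ∀ {x y} → C x → C y → x ≼ y ⊎ y ≼ x

Antichain : ∀ {n} → Rel (Fin n) ℓ → Pred (Fin n) p → Set _
Antichain _≼_ C = ∀ {x y} → C x → C y → x ≼ y → x ≡ y

module _ {n : ℕ} {_≼_ : Rel (Fin n) ℓ} (isPartialOrder : IsPartialOrder _≡_ _≼_)
         (_≼?_ : Relation.Binary.Decidable _≼_)
         (below-comparable : ∀ {a b x} → a ≼ x → b ≼ x → a ≼ b ⊎ b ≼ a) where
  open IsPartialOrder isPartialOrder using () renaming (refl to ≼-refl; trans to ≼-trans; antisym to ≼-antisym)

  private
    shrink : ∀ {r c} {R : Pred (Fin n) r} {C : Pred (Fin n) c} (C? : Decidable C) → (∀ {x} → C x → R x) →
             ∀ t → t ≤ count C? → Chain _≼_ C ⊎ Antichain _≼_ C →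
             Σ (Subset n) λ S → (∀ {x} → x ∈ S → R x) × ∣ S ∣ ≡ t × (Chain _≼_ (_∈ S) ⊎ Antichain _≼_ (_∈ S))
    shrink C? C⊆R t t≤|C| shape with subset-of-size C? t t≤|C|
    ... | S , S⊆C , |S| = S , (λ x∈S → C⊆R (S⊆C x∈S)) , |S| , restrict shape
      where
      restrict : Chain _≼_ _ ⊎ Antichain _≼_ _ → Chain _≼_ (_∈ S) ⊎ Antichain _≼_ (_∈ S)
      restrict (inj₁ chain) = inj₁ λ x∈S y∈S → chain (S⊆C x∈S) (S⊆C y∈S)
      restrict (inj₂ anti)  = inj₂ λ x∈S y∈S → anti (S⊆C x∈S) (S⊆C y∈S)

    module _ {r} {R : Pred (Fin n) r} (R? : Decidable R) where
      below? : ∀ x → Decidable (λ a → R a × a ≼ x)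
      below? x a = R? a ×-dec a ≼? x

      height : Fin n → ℕ
      height x = count (below? x)

      Layer : ∀ {s} → Fin s → Pred (Fin n) r
      Layer j x = R x × height x ≡ suc (toℕ j)

      layer? : ∀ {s} (j : Fin s) → Decidable (Layer j)
      layer? j x = R? x ×-dec height x ≟ₙ suc (toℕ j)

      layer-antichain : ∀ {s} (j : Fin s) → Antichain _≼_ (Layer j)
      layer-antichain j {x} {y} (_ , hx) (Ry , hy) x≼y with x ≟ y
      ... | yes x≡y = x≡y
      ... | no  x≢y = contradiction (trans hx (sym hy))
                        (<⇒≢ (count-strict (below? x) (below? y) (λ (Ra , a≼x) → Ra , ≼-trans a≼x x≼y)
                                           y (Ry , ≼-refl) (λ (_ , y≼x) → x≢y (≼-antisym x≼y y≼x))))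

      in-layer : ∀ {s x} → R x → height x ≤ s → ∃ λ (j : Fin s) → Layer j x
      in-layer {x = x} Rx hx≤s with height x | count>0 (below? x) (Rx , ≼-refl)
      ... | suc h | _ = fromℕ< hx≤s , Rx , cong suc (sym (toℕ-fromℕ< hx≤s))

      large⇒chain-or-antichain : ∀ s → s * s < count R? →
        Σ (Subset n) λ S → (∀ {x} → x ∈ S → R x) × ∣ S ∣ ≡ suc s × (Chain _≼_ (_∈ S) ⊎ Antichain _≼_ (_∈ S))
      large⇒chain-or-antichain s large with any? (λ x → R? x ×-dec s <? height x)
      ... | yes (x , _ , s<hx) = shrink (below? x) proj₁ (suc s) s<hx (inj₁ λ (_ , a≼x) (_ , b≼x) → below-comparable a≼x b≼x)
      ... | no ¬tall with any? (λ (j : Fin s) → s <? count (layer? j))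
      ...   | yes (j , s<|j|) = shrink (layer? j) proj₁ (suc s) s<|j| (inj₂ (layer-antichain j))
      ...   | no ¬wide = contradiction large (≤⇒≯ (begin
        count R?                                         ≤⟨ count-mono R? _ (λ Rx → in-layer Rx (≮⇒≥ λ s<hx → ¬tall (_ , Rx , s<hx))) ⟩
        count (λ x → any? (λ (j : Fin s) → layer? j x))  ≤⟨ count-⋃ s layer? s (λ j → ≮⇒≥ λ s<|j| → ¬wide (j , s<|j|)) ⟩
        s * s                                            ∎))
        where open ≤-Reasoning

  mirsky : ∀ {r} {R : Pred (Fin n) r} (R? : Decidable R) t → (t ∸ 1) * (t ∸ 1) < count R? →
           Σ (Subset n) λ S → (∀ {x} → x ∈ S → R x) × ∣ S ∣ ≡ t × (Chain _≼_ (_∈ S) ⊎ Antichain _≼_ (_∈ S))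
  mirsky R? zero    _     = shrink ∅? (λ ()) 0 z≤n (inj₂ λ ())
  mirsky R? (suc s) large = large⇒chain-or-antichain R? s large

linked-∷ʳ⁺ : ∀ {A : Set} {R : A → A → Set} xs {a b} → Linked R (xs ++ [ a ]) → R a b → Linked R ((xs ++ [ a ]) ++ [ b ])
linked-∷ʳ⁺ []           _          Rab = Rab ∷ [-]
linked-∷ʳ⁺ (x ∷ [])     (Rxa ∷ [-]) Rab = Rxa ∷ Rab ∷ [-]
linked-∷ʳ⁺ (x ∷ y ∷ xs) (Rxy ∷ l)  Rab = Rxy ∷ linked-∷ʳ⁺ (y ∷ xs) l Rab

module RootedTree {n : ℕ} (G : Graph n) (tree : IsTree G) where
  open Graph G using (adj)

  root : Fin n
  root = proj₁ (proj₁ tree)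

  Adj? : ∀ u v → Dec (Adj G u v)
  Adj? u v = adj u v Boolₚ.≟ true

  adj-sym : ∀ {u v} → Adj G u v → Adj G v u
  adj-sym {u} {v} uv = trans (Graph.sym G v u) uv

  adj⇒≢ : ∀ {u v} → Adj G u v → u ≢ v
  adj⇒≢ {u} uv refl = contradiction (trans (sym uv) (Graph.irrefl G u)) λ ()

  Within : ℕ → Pred (Fin n) 0ℓ
  Within zero    v = v ≡ root
  Within (suc j) v = Within j v ⊎ ∃ λ w → Adj G v w × Within j w

  within? : ∀ j → Decidable (Within j)
  within? zero    v = v ≟ root
  within? (suc j) v = within? j v ⊎-dec any? (λ w → Adj? v w ×-dec within? j w)

  walk⇒within : ∀ {v} → WalkIn G ⊤ v root → ∃ λ j → Within j v
  walk⇒within (here _)       = 0 , refl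
  walk⇒within (step _ vw wk) with walk⇒within wk
  ... | j , Wj = suc j , inj₂ (_ , vw , Wj)

  -- Opaque because unfolding the searches behind depth and parent makes type checking very slow.
  opaque
    private
      depth-spec : ∀ v → Σ ℕ λ j → Within j v × (∀ i → Within i v → j ≤ i)
      depth-spec v with walk⇒within (proj₁ (proj₂ tree) v root ∈⊤ ∈⊤)
      ... | j , Wj = least-witness (λ i → within? i v) j Wj

    depth : Fin n → ℕ
    depth v = proj₁ (depth-spec v)

    within-depth : ∀ v → Within (depth v) v
    within-depth v = proj₁ (proj₂ (depth-spec v))

    depth-minimal : ∀ v i → Within i v → depth v ≤ i
    depth-minimal v = proj₂ (proj₂ (depth-spec v))

  depth-adj : ∀ {u v} → Adj G u v → depth u ≤ suc (depth v)
  depth-adj {u} {v} uv = depth-minimal u (suc (depth v)) (inj₂ (v , uv , within-depth v))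

  depth≡0⇒root : ∀ {v} → depth v ≡ 0 → v ≡ root
  depth≡0⇒root {v} d≡0 = subst (λ j → Within j v) d≡0 (within-depth v)

  depth-root : depth root ≡ 0
  depth-root = n≤0⇒n≡0 (depth-minimal root 0 refl)

  depth-suc⇒≢root : ∀ {v j} → depth v ≡ suc j → v ≢ root
  depth-suc⇒≢root d≡1+j refl = 1+n≢0 (trans (sym d≡1+j) depth-root)

  descend : ∀ v → v ≢ root → ∃ λ w → Adj G v w × suc (depth w) ≡ depth v
  descend v v≢r with depth v in d≡ | within-depth v | depth-minimal v
  ... | zero  | _                  | _     = contradiction (depth≡0⇒root d≡) v≢r
  ... | suc j | inj₁ Wj            | least = contradiction (least j Wj) (<-irrefl refl)
  ... | suc j | inj₂ (w , vw , Wj) | _     =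
    w , vw , cong suc (≤-antisym (depth-minimal w j Wj) (s≤s⁻¹ (subst (_≤ suc (depth w)) d≡ (depth-adj vw))))

  opaque
    parent : Fin n → Fin n
    parent v = choose (λ w → Adj? v w ×-dec depth w <? depth v) root

    parent-spec : ∀ v → v ≢ root → Adj G v (parent v) × suc (depth (parent v)) ≡ depth v
    parent-spec v v≢r with descend v v≢r
    ... | w , vw , d≡ with choose-satisfies (λ w → Adj? v w ×-dec depth w <? depth v) root (w , vw , ≤-reflexive d≡)
    ... | vp , p<v = vp , ≤-antisym p<v (depth-adj vp)

    parent-root : parent root ≡ root
    parent-root = choose-default (λ w → Adj? root w ×-dec depth w <? depth root) root
      λ (w , _ , w<r) → n≮0 (subst (depth w <_) depth-root w<r)

  depth-parent : ∀ v → depth (parent v) ≡ depth v ∸ 1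
  depth-parent v with v ≟ root
  ... | yes refl = trans (cong depth parent-root) (trans depth-root (cong (_∸ 1) (sym depth-root)))
  ... | no v≢r   = cong (_∸ 1) (proj₂ (parent-spec v v≢r))

  depth-child : ∀ {c} → c ≢ root → depth c ≡ suc (depth (parent c))
  depth-child c≢r = sym (proj₂ (parent-spec _ c≢r))

  depth-sibling : ∀ {w₁ w₂} → w₁ ≢ root → w₂ ≢ root → parent w₁ ≡ parent w₂ → depth w₁ ≡ depth w₂
  depth-sibling w₁≢r w₂≢r p₁≡p₂ = trans (depth-child w₁≢r) (trans (cong (λ v → suc (depth v)) p₁≡p₂) (sym (depth-child w₂≢r)))

  ancestor : ℕ → Fin n → Fin n
  ancestor zero    x = x
  ancestor (suc j) x = parent (ancestor j x)

  ancestor-+ : ∀ i j x → ancestor i (ancestor j x) ≡ ancestor (i + j) x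
  ancestor-+ zero    j x = refl
  ancestor-+ (suc i) j x = cong parent (ancestor-+ i j x)

  depth-ancestor : ∀ j x → depth (ancestor j x) ≡ depth x ∸ j
  depth-ancestor zero    x = refl
  depth-ancestor (suc j) x = begin
    depth (parent (ancestor j x)) ≡⟨ depth-parent (ancestor j x) ⟩
    depth (ancestor j x) ∸ 1      ≡⟨ cong (_∸ 1) (depth-ancestor j x) ⟩
    depth x ∸ j ∸ 1               ≡⟨ ∸-+-assoc (depth x) j 1 ⟩
    depth x ∸ (j + 1)             ≡⟨ cong (depth x ∸_) (+-comm j 1) ⟩
    depth x ∸ suc j               ∎
    where open ≡-Reasoning

  -- a ≼ x: a lies on the path from x to the root, i.e. it is the ancestor of x at a's depth.
  _≼_ : Fin n → Fin n → Set
  a ≼ x = ancestor (depth x ∸ depth a) x ≡ a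

  _≼?_ : ∀ a x → Dec (a ≼ x)
  a ≼? x = ancestor (depth x ∸ depth a) x ≟ a

  ≼⇒depth≤ : ∀ {a x} → a ≼ x → depth a ≤ depth x
  ≼⇒depth≤ {a} {x} a≼x = begin
    depth a                                      ≡⟨ cong depth a≼x ⟨
    depth (ancestor (depth x ∸ depth a) x)       ≡⟨ depth-ancestor (depth x ∸ depth a) x ⟩
    depth x ∸ (depth x ∸ depth a)                ≤⟨ m∸n≤m (depth x) (depth x ∸ depth a) ⟩
    depth x                                      ∎
    where open ≤-Reasoning

  ≼-refl : ∀ {x} → x ≼ x
  ≼-refl {x} = cong (λ j → ancestor j x) (n∸n≡0 (depth x))

  ≼-same-depth : ∀ {a b x} → a ≼ x → b ≼ x → depth a ≡ depth b → a ≡ b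
  ≼-same-depth {x = x} a≼x b≼x d≡ = trans (sym a≼x) (trans (cong (λ d → ancestor (depth x ∸ d) x) d≡) b≼x)

  private
    ∸-telescope : ∀ {a b c} → a ≤ b → b ≤ c → (b ∸ a) + (c ∸ b) ≡ c ∸ a
    ∸-telescope {a} {b} {c} a≤b b≤c = +-cancelʳ-≡ a _ _ (begin
      (b ∸ a) + (c ∸ b) + a   ≡⟨ +-assoc (b ∸ a) (c ∸ b) a ⟩
      (b ∸ a) + ((c ∸ b) + a) ≡⟨ cong ((b ∸ a) +_) (+-comm (c ∸ b) a) ⟩
      (b ∸ a) + (a + (c ∸ b)) ≡⟨ +-assoc (b ∸ a) a (c ∸ b) ⟨
      (b ∸ a) + a + (c ∸ b)   ≡⟨ cong (_+ (c ∸ b)) (m∸n+n≡m a≤b) ⟩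
      b + (c ∸ b)             ≡⟨ m+[n∸m]≡n b≤c ⟩
      c                       ≡⟨ m∸n+n≡m (≤-trans a≤b b≤c) ⟨
      (c ∸ a) + a             ∎)
      where open ≡-Reasoning

  ≼-trans : ∀ {a b x} → a ≼ b → b ≼ x → a ≼ x
  ≼-trans {a} {b} {x} a≼b b≼x = begin
    ancestor (depth x ∸ depth a) x                                   ≡⟨ cong (λ j → ancestor j x) (∸-telescope (≼⇒depth≤ a≼b) (≼⇒depth≤ b≼x)) ⟨
    ancestor ((depth b ∸ depth a) + (depth x ∸ depth b)) x           ≡⟨ ancestor-+ (depth b ∸ depth a) (depth x ∸ depth b) x ⟨
    ancestor (depth b ∸ depth a) (ancestor (depth x ∸ depth b) x)    ≡⟨ cong (ancestor (depth b ∸ depth a)) b≼x ⟩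
    ancestor (depth b ∸ depth a) b                                   ≡⟨ a≼b ⟩
    a                                                                ∎
    where open ≡-Reasoning

  ≼-by-depth : ∀ {a b x} → a ≼ x → b ≼ x → depth a ≤ depth b → a ≼ b
  ≼-by-depth {a} {b} {x} a≼x b≼x a≤b = begin
    ancestor (depth b ∸ depth a) b                                   ≡⟨ cong (ancestor (depth b ∸ depth a)) b≼x ⟨
    ancestor (depth b ∸ depth a) (ancestor (depth x ∸ depth b) x)    ≡⟨ ancestor-+ (depth b ∸ depth a) (depth x ∸ depth b) x ⟩
    ancestor ((depth b ∸ depth a) + (depth x ∸ depth b)) x           ≡⟨ cong (λ j → ancestor j x) (∸-telescope a≤b (≼⇒depth≤ b≼x)) ⟩
    ancestor (depth x ∸ depth a) x                                   ≡⟨ a≼x ⟩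
    a                                                                ∎
    where open ≡-Reasoning

  ≼-antisym : ∀ {a b} → a ≼ b → b ≼ a → a ≡ b
  ≼-antisym a≼b b≼a = ≼-same-depth a≼b ≼-refl (≤-antisym (≼⇒depth≤ a≼b) (≼⇒depth≤ b≼a))

  ≼-isPartialOrder : IsPartialOrder _≡_ _≼_
  ≼-isPartialOrder = record
    { isPreorder = record
      { isEquivalence = isEquivalence
      ; reflexive     = λ { refl → ≼-refl }
      ; trans         = ≼-trans
      }
    ; antisym = ≼-antisym
    }

  ancestors-comparable : ∀ {a b x} → a ≼ x → b ≼ x → a ≼ b ⊎ b ≼ a
  ancestors-comparable {a} {b} a≼x b≼x with ≤-total (depth a) (depth b)
  ... | inj₁ a≤b = inj₁ (≼-by-depth a≼x b≼x a≤b)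
  ... | inj₂ b≤a = inj₂ (≼-by-depth b≼x a≼x b≤a)

  parent-≼ : ∀ v → parent v ≼ v
  parent-≼ v with v ≟ root
  ... | yes refl rewrite parent-root = ≼-refl
  ... | no v≢r   = cong (λ j → ancestor j v) (begin
    depth v ∸ depth (parent v)                  ≡⟨ cong (_∸ depth (parent v)) (proj₂ (parent-spec v v≢r)) ⟨
    suc (depth (parent v)) ∸ depth (parent v)   ≡⟨ m+n∸n≡m 1 (depth (parent v)) ⟩
    1                                           ∎)
    where open ≡-Reasoning

  private
    deeper⇒≢ : ∀ {u w D} → depth u ≡ suc D → depth w ≤ D → u ≢ w
    deeper⇒≢ {D = D} du dw≤D refl = n≮n D (≤-trans (≤-reflexive (sym du)) dw≤D)

  record Bridge (D : ℕ) (x y : Fin n) : Set where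
    field
      inner    : List (Fin n)
      distinct : AllPairs _≢_ (x ∷ inner ++ [ y ])
      linked   : Linked (Adj G) (x ∷ inner ++ [ y ])
      shallow  : All (λ z → depth z ≤ D) (x ∷ inner ++ [ y ])
      nonempty : 1 ≤ length inner

  bridge : ∀ D {x y} → depth x ≡ D → depth y ≡ D → x ≢ y → Bridge D x y
  bridge zero    dx dy x≢y = contradiction (trans (depth≡0⇒root dx) (sym (depth≡0⇒root dy))) x≢y
  bridge (suc D) {x} {y} dx dy x≢y with parent-spec x (depth-suc⇒≢root dx) | parent-spec y (depth-suc⇒≢root dy)
  ... | x-px , dpx | y-py , dpy with parent x ≟ parent y
  ... | yes px≡py = record
    { inner    = [ parent x ]
    ; distinct = (deeper⇒≢ dx (≤-reflexive dpx′) ∷ x≢y ∷ []) ∷ (≢-sym (deeper⇒≢ dy (≤-reflexive dpx′)) ∷ []) ∷ [] ∷ []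
    ; linked   = x-px ∷ subst (λ z → Adj G z y) (sym px≡py) (adj-sym y-py) ∷ [-]
    ; shallow  = ≤-reflexive dx ∷ ≤-trans (≤-reflexive dpx′) (n≤1+n D) ∷ ≤-reflexive dy ∷ []
    ; nonempty = s≤s z≤n
    }
    where
    dpx′ : depth (parent x) ≡ D
    dpx′ = suc-injective (trans dpx dx)
  ... | no px≢py = record
    { inner    = parent x ∷ inner ++ [ parent y ]
    ; distinct = ∷ʳ⁺ (All.map (deeper⇒≢ dx) shallow) x≢y
               ∷ AllPairsₚ.++⁺ distinct ([] ∷ []) (All.map (λ dz≤D → ≢-sym (deeper⇒≢ dy dz≤D) ∷ []) shallow)
    ; linked   = x-px ∷ linked-∷ʳ⁺ (parent x ∷ inner) linked (adj-sym y-py)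
    ; shallow  = ≤-reflexive dx ∷ ∷ʳ⁺ (All.map m≤n⇒m≤1+n shallow) (≤-reflexive dy)
    ; nonempty = s≤s z≤n
    }
    where open Bridge (bridge D (suc-injective (trans dpx dx)) (suc-injective (trans dpy dy)) px≢py)

  private
    acyclic : Acyclic G
    acyclic = proj₂ (proj₂ tree)

    path-cycle : ∀ x M y → AllPairs _≢_ (x ∷ M ++ [ y ]) → Linked (Adj G) (x ∷ M ++ [ y ]) →
                 1 ≤ length M → Adj G y x → IsCycle G x (M ++ [ y ])
    path-cycle x M y distinct linked 1≤|M| yx =
      distinct , subst (2 ≤_) (sym (length-++ M)) (+-monoˡ-≤ 1 1≤|M|) , linked-∷ʳ⁺ (x ∷ M) linked yx

  adj⇒depth≢ : ∀ {a b} → Adj G a b → depth a ≢ depth b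
  adj⇒depth≢ {a} {b} ab da≡db = acyclic a (inner ++ [ b ]) (path-cycle a inner b distinct linked nonempty (adj-sym ab))
    where open Bridge (bridge (depth a) refl (sym da≡db) (adj⇒≢ ab))

  adj-up⇒parent : ∀ {a b} → Adj G a b → suc (depth b) ≡ depth a → parent a ≡ b
  adj-up⇒parent {a} {b} ab db<da with parent a ≟ b | parent-spec a (depth-suc⇒≢root (sym db<da))
  ... | yes pa≡b | _          = pa≡b
  ... | no pa≢b  | a-pa , dpa =
    contradiction (path-cycle a (parent a ∷ inner) b (All.map a≢ shallow ∷ distinct) (a-pa ∷ linked) (s≤s z≤n) (adj-sym ab))
                  (acyclic a _)
    where
    open Bridge (bridge (depth b) (suc-injective (trans dpa (sym db<da))) refl pa≢b)
    a≢ : ∀ {z} → depth z ≤ depth b → a ≢ z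
    a≢ dz≤db refl = n≮n (depth b) (≤-trans (≤-reflexive db<da) dz≤db)

  neighbour-parent-or-child : ∀ {q w} → Adj G q w → w ≡ parent q ⊎ parent w ≡ q × w ≢ root
  neighbour-parent-or-child {q} {w} qw with <-cmp (depth w) (depth q)
  ... | tri≈ _ dw≡dq _ = contradiction (sym dw≡dq) (adj⇒depth≢ qw)
  ... | tri< dw<dq _ _ = inj₁ (sym (adj-up⇒parent qw (≤-antisym dw<dq (depth-adj qw))))
  ... | tri> _ _ dq<dw = inj₂ (adj-up⇒parent (adj-sym qw) dq+1≡dw , depth-suc⇒≢root (sym dq+1≡dw))
    where
    dq+1≡dw : suc (depth q) ≡ depth w
    dq+1≡dw = ≤-antisym dq<dw (depth-adj (adj-sym qw))

  module _ (S : Subset n) (root∈S : root ∈ S) (parent∈S : ∀ {v} → v ∈ S → parent v ∈ S) where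
    private
      walk-start : ∀ {u v} → WalkIn G S u v → u ∈ S
      walk-start (here u∈S)     = u∈S
      walk-start (step u∈S _ _) = u∈S

      _++ʷ_ : ∀ {u v w} → WalkIn G S u v → WalkIn G S v w → WalkIn G S u w
      here _          ++ʷ w₂ = w₂
      step u∈S uv w₁ ++ʷ w₂ = step u∈S uv (w₁ ++ʷ w₂)

      reverse : ∀ {u v} → WalkIn G S u v → WalkIn G S v u
      reverse (here u∈S)       = here u∈S
      reverse (step u∈S uv wk) = reverse wk ++ʷ step (walk-start wk) (adj-sym uv) (here u∈S)

      walk-to-root : ∀ D {u} → depth u ≡ D → u ∈ S → WalkIn G S u root
      walk-to-root zero    du u∈S = subst (λ z → WalkIn G S z root) (sym (depth≡0⇒root du)) (here root∈S)
      walk-to-root (suc D) du u∈S with parent-spec _ (depth-suc⇒≢root du)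
      ... | u-pu , dpu = step u∈S u-pu (walk-to-root D (suc-injective (trans dpu du)) (parent∈S u∈S))

    parent-closed⇒connected : ConnectedIn G S
    parent-closed⇒connected u v u∈S v∈S = walk-to-root _ refl u∈S ++ʷ reverse (walk-to-root _ refl v∈S)

∈-tabulate⁻ : ∀ {n} {f : Fin n → Bool} {x} → x ∈ tabulate f → f x ≡ true
∈-tabulate⁻ {f = f} {x} x∈ = trans (sym (lookup∘tabulate f x)) ([]=⇒lookup x∈)

toSubset : ∀ {n p} {P : Pred (Fin n) p} → Decidable P → Subset n
toSubset P? = tabulate (λ x → does (P? x))

∈-toSubset⁺ : ∀ {n p} {P : Pred (Fin n) p} (P? : Decidable P) {x} → P x → x ∈ toSubset P?
∈-toSubset⁺ P? {x} Px = lookup⇒[]= x _ (trans (lookup∘tabulate _ x) (dec-true (P? x) Px))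

∈-toSubset⁻ : ∀ {n p} {P : Pred (Fin n) p} (P? : Decidable P) {x} → x ∈ toSubset P? → P x
∈-toSubset⁻ P? {x} x∈ with P? x | ∈-tabulate⁻ {f = λ y → does (P? y)} x∈
... | yes Px | _ = Px

m^2≡m*m : ∀ m → m ^ 2 ≡ m * m
m^2≡m*m m = cong (m *_) (*-identityʳ m)

m≤m^2 : ∀ m → m ≤ m ^ 2
m≤m^2 zero      = z≤n
m≤m^2 m@(suc _) = ≤-trans (m≤m*n m m) (≤-reflexive (sym (m^2≡m*m m)))

module Construction {n : ℕ} (G : Graph n) (tree : IsTree G) where
  open RootedTree G tree

  module _ {m k : ℕ} (C : Fin m → Subset n) (∣C∣ : ∀ i → ∣ C i ∣ ≡ m * k)
           (shape : ∀ i → Chain _≼_ (_∈ C i) ⊎ Antichain _≼_ (_∈ C i)) where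

    Marked : Pred (Fin n) 0ℓ
    Marked x = ∃ λ j → x ∈ C j

    marked? : Decidable Marked
    marked? x = any? (λ j → x ∈? C j)

    count-C : ∀ i → count (_∈? C i) ≡ m * k
    count-C i = trans (sym (∣p∣≡count (C i))) (∣C∣ i)

    count-marked : count marked? ≤ m * (m * k)
    count-marked = count-⋃ m (λ j x → x ∈? C j) (m * k) (λ j → ≤-reflexive (count-C j))

    Span : Pred (Fin n) 0ℓ
    Span x = x ≡ root ⊎ ∃ λ q → Marked q × x ≼ q

    span? : Decidable Span
    span? x = x ≟ root ⊎-dec any? (λ q → marked? q ×-dec x ≼? q)

    span-parent : ∀ {v} → Span v → Span (parent v)
    span-parent (inj₁ refl)            = inj₁ parent-root
    span-parent (inj₂ (q , Mq , v≼q)) = inj₂ (q , Mq , ≼-trans (parent-≼ _) v≼q)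

    subtree : Subset n
    subtree = toSubset span?

    subtree-isSubtree : IsSubtree G subtree
    subtree-isSubtree = (root , root∈) , parent-closed⇒connected subtree root∈ parent∈
      where
      root∈ : root ∈ subtree
      root∈ = ∈-toSubset⁺ span? (inj₁ refl)
      parent∈ : ∀ {v} → v ∈ subtree → parent v ∈ subtree
      parent∈ v∈ = ∈-toSubset⁺ span? (span-parent (∈-toSubset⁻ span? v∈))

    degIn-subtree : ∀ v → degIn G subtree v ≤ count (λ w → Adj? v w ×-dec span? w)
    degIn-subtree v = begin
      ∣ N G v ∩ subtree ∣                 ≡⟨ ∣p∣≡count (N G v ∩ subtree) ⟩
      count (_∈? N G v ∩ subtree)         ≤⟨ count-mono (_∈? N G v ∩ subtree) (λ w → Adj? v w ×-dec span? w) split ⟩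
      count (λ w → Adj? v w ×-dec span? w) ∎
      where
      open ≤-Reasoning
      split : ∀ {w} → w ∈ N G v ∩ subtree → Adj G v w × Span w
      split w∈ with x∈p∩q⁻ (N G v) subtree w∈
      ... | w∈N , w∈S = ∈-tabulate⁻ w∈N , ∈-toSubset⁻ span? w∈S

    module Colour (i : Fin m) where
      0<m : 0 < m
      0<m = ≤-trans (s≤s z≤n) (toℕ<n i)

      Above : Pred (Fin n) 0ℓ
      Above c = ∃ λ x → x ∈ C i × c ≼ x

      above? : Decidable Above
      above? c = any? (λ x → x ∈? C i ×-dec c ≼? x)

      Stub : Pred (Fin n) 0ℓ
      Stub c = c ≢ root × parent c ∈ C i × Span c × ¬ Above c

      stub? : Decidable Stub
      stub? c = ¬? (c ≟ root) ×-dec parent c ∈? C i ×-dec span? c ×-dec ¬? (above? c)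

      stub-children? : ∀ q → Decidable (λ c → Stub c × parent c ≡ q)
      stub-children? q c = stub? c ×-dec parent c ≟ q

      Heavy : Pred (Fin n) 0ℓ
      Heavy q = m ∸ 1 < count (stub-children? q)

      heavy? : Decidable Heavy
      heavy? q = m ∸ 1 <? count (stub-children? q)

      witness : Fin n → Fin n
      witness c = choose (λ x → marked? x ×-dec c ≼? x) c

      witness-spec : ∀ {c} → Stub c → Marked (witness c) × c ≼ witness c
      witness-spec {c} (c≢r , _ , span , _) with span
      ... | inj₁ c≡r      = contradiction c≡r c≢r
      ... | inj₂ (q , Mq , c≼q) = choose-satisfies (λ x → marked? x ×-dec c ≼? x) c (q , Mq , c≼q)

      stub-witness-gap : ∀ {c q} → Stub c → q ∈ C i → q ≼ witness c → depth q ≤ depth (parent c)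
      stub-witness-gap {c} {q} stub@(c≢r , _ , _ , ¬above) q∈C q≼w with depth q ≤? depth (parent c)
      ... | yes dq≤dp = dq≤dp
      ... | no  dq≰dp = contradiction (q , q∈C , ≼-by-depth (proj₂ (witness-spec stub)) q≼w dc≤dq) ¬above
        where
        dc≤dq : depth c ≤ depth q
        dc≤dq = ≤-trans (≤-reflexive (depth-child c≢r)) (≰⇒> dq≰dp)

      witness-injective : ∀ {c c′} → Stub c → Stub c′ → witness c ≡ witness c′ → c ≡ c′
      witness-injective {c} {c′} stub@(c≢r , pc∈C , _) stub′@(c′≢r , pc′∈C , _) w≡w′ =
        ≼-same-depth c≼w c′≼w (begin
          depth c                 ≡⟨ depth-child c≢r ⟩
          suc (depth (parent c))  ≡⟨ cong suc (≤-antisym pc≤pc′ pc′≤pc) ⟩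
          suc (depth (parent c′)) ≡⟨ depth-child c′≢r ⟨
          depth c′                ∎)
        where
        open ≡-Reasoning
        c≼w : c ≼ witness c
        c≼w = proj₂ (witness-spec stub)
        c′≼w : c′ ≼ witness c
        c′≼w = subst (c′ ≼_) (sym w≡w′) (proj₂ (witness-spec stub′))
        pc≤pc′ : depth (parent c) ≤ depth (parent c′)
        pc≤pc′ = stub-witness-gap stub′ pc∈C (subst (parent c ≼_) w≡w′ (≼-trans (parent-≼ c) c≼w))
        pc′≤pc : depth (parent c′) ≤ depth (parent c)
        pc′≤pc = stub-witness-gap stub pc′∈C (≼-trans (parent-≼ c′) c′≼w)

      witness-∉C : ∀ {c} → Stub c → witness c ∉ C i
      witness-∉C stub@(_ , _ , _ , ¬above) w∈C = ¬above (_ , w∈C , proj₂ (witness-spec stub))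

      good? : Decidable (λ q → q ∈ C i × ¬ Heavy q)
      good? q = q ∈? C i ×-dec ¬? (heavy? q)

      count-stubs : count stub? ≤ count (λ x → marked? x ×-dec ¬? (x ∈? C i))
      count-stubs = count-injection stub? _ witness (λ stub → proj₁ (witness-spec stub) , witness-∉C stub) witness-injective

      count-marked-∉C : count (λ x → marked? x ×-dec ¬? (x ∈? C i)) + m * k ≤ m * (m * k)
      count-marked-∉C = begin
        count marked∉C? + m * k                              ≡⟨ +-comm (count marked∉C?) (m * k) ⟩
        m * k + count marked∉C?                              ≡⟨ cong (_+ count marked∉C?) (count-C i) ⟨
        count (_∈? C i) + count marked∉C?                    ≤⟨ +-monoˡ-≤ (count marked∉C?) (count-mono (_∈? C i) _ (λ x∈C → (i , x∈C) , x∈C)) ⟩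
        count (λ x → marked? x ×-dec x ∈? C i) + count marked∉C? ≡⟨ count-split marked? (_∈? C i) ⟨
        count marked?                                        ≤⟨ count-marked ⟩
        m * (m * k)                                          ∎
        where
        open ≤-Reasoning
        marked∉C? : Decidable (λ x → Marked x × x ∉ C i)
        marked∉C? x = marked? x ×-dec ¬? (x ∈? C i)

      count-heavy : m * count (λ q → q ∈? C i ×-dec heavy? q) ≤ count stub?
      count-heavy = count-fibres _ stub? m parent (λ (_ , heavy) → ≤-trans (m≤n+m∸n m 1) heavy)

      count-good : k ≤ count good?
      count-good = +-cancelˡ-≤ (count heavyC?) k (count good?) (begin
        count heavyC? + k                     ≤⟨ *-cancelˡ-≤ m {{>-nonZero 0<m}} m*[h+k]≤m*mk ⟩
        m * k                                 ≡⟨ count-C i ⟨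
        count (_∈? C i)                       ≡⟨ count-split (_∈? C i) heavy? ⟩
        count heavyC? + count good?           ∎)
        where
        open ≤-Reasoning
        heavyC? : Decidable (λ q → q ∈ C i × Heavy q)
        heavyC? q = q ∈? C i ×-dec heavy? q
        m*[h+k]≤m*mk : m * (count heavyC? + k) ≤ m * (m * k)
        m*[h+k]≤m*mk = begin
          m * (count heavyC? + k)                                   ≡⟨ *-distribˡ-+ m (count heavyC?) k ⟩
          m * count heavyC? + m * k                                 ≤⟨ +-monoˡ-≤ (m * k) (≤-trans count-heavy count-stubs) ⟩
          count (λ x → marked? x ×-dec ¬? (x ∈? C i)) + m * k       ≤⟨ count-marked-∉C ⟩
          m * (m * k)                                               ∎

      AboveChild : Fin n → Pred (Fin n) 0ℓ
      AboveChild q w = parent w ≡ q × w ≢ root × Above w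

      above-child? : ∀ q → Decidable (AboveChild q)
      above-child? q w = parent w ≟ q ×-dec ¬? (w ≟ root) ×-dec above? w

      -- In a chain the vertices of C i below q all hang from one child; in an antichain none does.
      above-child-unique : ∀ {q w₁ w₂} → q ∈ C i → AboveChild q w₁ → AboveChild q w₂ → w₁ ≡ w₂
      above-child-unique {q} {w₁} {w₂} q∈C (pw₁≡q , w₁≢r , x₁ , x₁∈C , w₁≼x₁) (pw₂≡q , w₂≢r , x₂ , x₂∈C , w₂≼x₂) =
        by-shape (shape i)
        where
        d₁≡d₂ : depth w₁ ≡ depth w₂
        d₁≡d₂ = depth-sibling w₁≢r w₂≢r (trans pw₁≡q (sym pw₂≡q))
        q≼x₁ : q ≼ x₁
        q≼x₁ = subst (_≼ x₁) pw₁≡q (≼-trans (parent-≼ w₁) w₁≼x₁)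
        by-shape : Chain _≼_ (_∈ C i) ⊎ Antichain _≼_ (_∈ C i) → w₁ ≡ w₂
        by-shape (inj₁ chain) with chain x₁∈C x₂∈C
        ... | inj₁ x₁≼x₂ = ≼-same-depth (≼-trans w₁≼x₁ x₁≼x₂) w₂≼x₂ d₁≡d₂
        ... | inj₂ x₂≼x₁ = ≼-same-depth w₁≼x₁ (≼-trans w₂≼x₂ x₂≼x₁) d₁≡d₂
        by-shape (inj₂ antichain) = contradiction (cong depth (antichain q∈C x₁∈C q≼x₁)) (<⇒≢ (begin-strict
          depth q                  ≡⟨ cong depth pw₁≡q ⟨
          depth (parent w₁)        <⟨ n<1+n _ ⟩
          suc (depth (parent w₁))  ≡⟨ depth-child w₁≢r ⟨
          depth w₁                 ≤⟨ ≼⇒depth≤ w₁≼x₁ ⟩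
          depth x₁                 ∎))
          where open ≤-Reasoning

      degree-good : ∀ {q} → q ∈ C i → ¬ Heavy q →
                    count (λ w → Adj? q w ×-dec span? w) ≤ m ^ 2 + 1
      degree-good {q} q∈C light = begin
        count (λ w → Adj? q w ×-dec span? w)                                              ≤⟨ count-mono _ neighbours? cover ⟩
        count neighbours?                                                                 ≤⟨ count-∪ (_≟ parent q) _ ⟩
        count (_≟ parent q) + count (λ w → above-child? q w ⊎-dec stub-children? q w)     ≤⟨ +-mono-≤ (count-≤1 (_≟ parent q) (λ p₁ p₂ → trans p₁ (sym p₂)))
                                                                                                      (count-∪ (above-child? q) (stub-children? q)) ⟩
        1 + (count (above-child? q) + count (stub-children? q))                           ≤⟨ +-monoʳ-≤ 1 (+-mono-≤ (count-≤1 (above-child? q) (above-child-unique q∈C)) (≮⇒≥ light)) ⟩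
        1 + (1 + (m ∸ 1))                                                                 ≡⟨ cong suc (m+[n∸m]≡n 0<m) ⟩
        1 + m                                                                             ≤⟨ s≤s (m≤m^2 m) ⟩
        1 + m ^ 2                                                                         ≡⟨ +-comm 1 (m ^ 2) ⟩
        m ^ 2 + 1                                                                         ∎
        where
        open ≤-Reasoning
        neighbours? : Decidable (λ w → w ≡ parent q ⊎ (AboveChild q w ⊎ (Stub w × parent w ≡ q)))
        neighbours? w = w ≟ parent q ⊎-dec (above-child? q w ⊎-dec stub-children? q w)
        cover : ∀ {w} → Adj G q w × Span w → w ≡ parent q ⊎ (AboveChild q w ⊎ (Stub w × parent w ≡ q))
        cover {w} (qw , span-w) with neighbour-parent-or-child qw
        ... | inj₁ w≡pq = inj₁ w≡pq
        ... | inj₂ (pw≡q , w≢r) with above? w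
        ...   | yes above = inj₂ (inj₁ (pw≡q , w≢r , above))
        ...   | no ¬above = inj₂ (inj₂ ((w≢r , subst (_∈ C i) (sym pw≡q) q∈C , span-w , ¬above) , pw≡q))

      low-degree-subset : Σ (Subset n) λ S → S ⊆ C i × S ⊆ subtree × ∣ S ∣ ≡ k ×
                                            (∀ v → v ∈ S → degIn G subtree v ≤ m ^ 2 + 1)
      low-degree-subset with subset-of-size good? k count-good
      ... | S , S⊆good , ∣S∣ =
        S , (λ v∈S → proj₁ (S⊆good v∈S)) ,
        (λ v∈S → ∈-toSubset⁺ span? (inj₂ (_ , (i , proj₁ (S⊆good v∈S)) , ≼-refl))) , ∣S∣ ,
        λ v v∈S → ≤-trans (degIn-subtree v) (degree-good (proj₁ (S⊆good v∈S)) (proj₂ (S⊆good v∈S)))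

lemma2p5 : ∀ {n : ℕ} (T : Graph n) → IsTree T →
           (k : ℕ) → 1 ≤ k →
           (m : ℕ) (R : Fin m → Subset n) →
           (∀ i j v → v ∈ R i → v ∈ R j → i ≡ j) →
           (∀ i → (m * k ∸ 1) ^ 2 < ∣ R i ∣) →
           Σ (Subset n) λ T′ → IsSubtree T T′ ×
             Σ (Fin m → Subset n) λ R′ → ∀ i →
               (R′ i ⊆ R i) × (R′ i ⊆ T′) × (∣ R′ i ∣ ≡ k) ×
               (∀ v → v ∈ R′ i → degIn T T′ v ≤ m ^ 2 + 1)
lemma2p5 {n} T tree k _ m R _ large =
  T′ , subtree-isSubtree C ∣C∣ shape ,
  (λ i → proj₁ (selection i)) , λ i → ⊆-trans (proj₁ (proj₂ (selection i))) C⊆R , proj₂ (proj₂ (selection i))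
  where
  open RootedTree T tree
  open Construction T tree

  chains : ∀ i → Σ (Subset n) λ S → S ⊆ R i × ∣ S ∣ ≡ m * k × (Chain _≼_ (_∈ S) ⊎ Antichain _≼_ (_∈ S))
  chains i = mirsky ≼-isPartialOrder _≼?_ ancestors-comparable (_∈? R i) (m * k)
                    (subst₂ _<_ (m^2≡m*m (m * k ∸ 1)) (∣p∣≡count (R i)) (large i))

  C : Fin m → Subset n
  C i = proj₁ (chains i)

  C⊆R : ∀ {i} → C i ⊆ R i
  C⊆R {i} = proj₁ (proj₂ (chains i))

  ∣C∣ : ∀ i → ∣ C i ∣ ≡ m * k
  ∣C∣ i = proj₁ (proj₂ (proj₂ (chains i)))

  shape : ∀ i → Chain _≼_ (_∈ C i) ⊎ Antichain _≼_ (_∈ C i)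
  shape i = proj₂ (proj₂ (proj₂ (chains i)))

  T′ : Subset n
  T′ = subtree C ∣C∣ shape

  selection : ∀ i → Σ (Subset n) λ S → S ⊆ C i × S ⊆ T′ × ∣ S ∣ ≡ k × (∀ v → v ∈ S → degIn T T′ v ≤ m ^ 2 + 1)
  selection = Colour.low-degree-subset C ∣C∣ shape
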